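{- For every $\epsilon>0$ there exists $k=O(1/\epsilon^2)$ and a self-bounding function $f:\{0,1\}^k\to[0,1]$ such that $\mathsf{deg}^{\ell_2}_\epsilon(f)=\Omega(1/\epsilon^2)$.
   Context: A function $f:\{0,1\}^k\to\mathbb{R}$ is self-bounding if it is $1$-Lipschitz (with respect to Hamming distance) and for all $x$, $\sum_{i=1}^k(f(x)-f(x\oplus e_i))_+\le f(x)$, where $x\oplus e_i$ is $x$ with the $i$-th bit flipped and $(\alpha)_+=\max\{0,\alpha\}$. $\mathsf{deg}^{\ell_2}_\epsilon(f)$ is the smallest $d$ such that some real polynomial $p$ of degree $d$ satisfies $\sqrt{\mathbb{E}_x[(f(x)-p(x))^2]}\le\epsilon$, $x$ uniform on $\{0,1\}^k$. Implied constants are absolute.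
   Formalization: The parameter ε ranges over the positive rationals, the approximating polynomials p have rational coefficients instead of real ones, and f takes rational values in [0,1]. -}

module Defs where

open import Data.Bool using (Bool; true; false; not)
open import Data.Nat as ℕ using (ℕ; zero; suc)
open import Data.Integer using (+_)
open import Data.Fin using (Fin)
open import Data.Vec using (Vec; []; _∷_; updateAt; zipWith; foldr)
open import Data.List as List using (List; []; _∷_; _++_; map; allFin)
open import Data.List.Relation.Unary.All using (All)
open import Data.Product using (Σ; _×_; proj₁; proj₂)
open import Data.Rational using (ℚ; 0ℚ; 1ℚ; _+_; _*_; _-_; _⊔_; ∣_∣; _≤_; _/_)

ℕtoℚ : ℕ → ℚ
ℕtoℚ n = (+ n) / 1

sumℚ : List ℚ → ℚ
sumℚ = List.foldr _+_ 0ℚ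

-- the Boolean cube {0,1}^k, points as bit vectors (true = 1)
Cube : ℕ → Set
Cube k = Vec Bool k

allPoints : (k : ℕ) → List (Cube k)
allPoints zero = [] ∷ []
allPoints (suc k) = map (false ∷_) (allPoints k) ++ map (true ∷_) (allPoints k)

flipAt : {k : ℕ} → Cube k → Fin k → Cube k
flipAt x i = updateAt x i not

hamming : {k : ℕ} → Cube k → Cube k → ℕ
hamming [] [] = 0
hamming (a ∷ x) (b ∷ y) = (if-diff a b) ℕ.+ hamming x y
  where
  if-diff : Bool → Bool → ℕ
  if-diff false false = 0
  if-diff true true = 0
  if-diff _ _ = 1

Lipschitz1 : {k : ℕ} → (Cube k → ℚ) → Set
Lipschitz1 {k} f = (x y : Cube k) → ∣ f x - f y ∣ ≤ ℕtoℚ (hamming x y)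

pos : ℚ → ℚ
pos a = 0ℚ ⊔ a

SelfBounding : {k : ℕ} → (Cube k → ℚ) → Set
SelfBounding {k} f =
  Lipschitz1 f ×
  ((x : Cube k) → sumℚ (map (λ i → pos (f x - f (flipAt x i))) (allFin k)) ≤ f x)

-- polynomials in k variables: a finite list of terms (coefficient, exponent vector)
Poly : ℕ → Set
Poly k = List (ℚ × Vec ℕ k)

monoDeg : {k : ℕ} → Vec ℕ k → ℕ
monoDeg = foldr _ ℕ._+_ 0

DegLE : {k : ℕ} → Poly k → ℕ → Set
DegLE p d = All (λ t → monoDeg (proj₂ t) ℕ.≤ d) p

bit : Bool → ℚ
bit false = 0ℚ
bit true = 1ℚ

powℚ : ℚ → ℕ → ℚ
powℚ a zero = 1ℚ
powℚ a (suc n) = a * powℚ a n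

evalMono : {k : ℕ} → Vec ℕ k → Cube k → ℚ
evalMono e x = foldr _ _*_ 1ℚ (zipWith (λ ei xi → powℚ (bit xi) ei) e x)

evalPoly : {k : ℕ} → Poly k → Cube k → ℚ
evalPoly p x = sumℚ (map (λ t → proj₁ t * evalMono (proj₂ t) x) p)

-- sqrt (E_x[(f x - p x)^2]) ≤ ε, for ε ≥ 0, written as
-- Σ_x (f x - p x)^2 ≤ 2^k · ε²
L2Close : {k : ℕ} → (Cube k → ℚ) → Poly k → ℚ → Set
L2Close {k} f p ε =
  sumℚ (map (λ x → (f x - evalPoly p x) * (f x - evalPoly p x)) (allPoints k))
    ≤ ℕtoℚ (2 ℕ.^ k) * (ε * ε)

-- some polynomial of degree ≤ d ε-approximates f in ℓ2
-- (deg^{ℓ2}_ε(f) is the least such d)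
ApproxDegLE : {k : ℕ} → (Cube k → ℚ) → ℚ → ℕ → Set
ApproxDegLE {k} f ε d = Σ (Poly k) (λ p → DegLE p d × L2Close f p ε)

{-# OPTIONS --safe #-}

-- f is the indicator of the non-codewords of the binary code C = {x ∈ F₂ᵏ : M x = 0} whose
-- parity-check matrix M has all k = 2ʳ vectors of F₂ʳ as columns. From a non-codeword x, exactly
-- one coordinate flip (the one whose column equals the syndrome M x) leads into C, so the drops
-- of f at x sum to 1 = f x: f is self-bounding. The dual of C is the Hadamard code, whose nonzero
-- words have weight 2ʳ⁻¹; hence the centred indicator h = μ - 1_C, with μ = 2⁻ʳ, has no Fourier
-- mass below level 2ʳ⁻¹ and is orthogonal to every polynomial of smaller degree. Writing
-- f - p = h - q with deg q = deg p < 2ʳ⁻¹ gives ‖f - p‖² ≥ ‖h‖² = μ (1 - μ). Choosing r with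
-- 2ε² < 2⁻ʳ ≤ 4ε² yields k = O(1/ε²) while every ε-approximation has degree at least 2ʳ⁻¹ = Ω(1/ε²).

module Submission where

open import Defs
open import Algebra.Bundles using (CommutativeRing)
import Algebra.Properties.CommutativeSemigroup as CommutativeSemigroupProperties
open import Data.Bool using (Bool; true; false; not; _∧_; _xor_; if_then_else_)
import Data.Bool.Properties as 𝔹ₚ
open import Data.Empty using (⊥-elim)
open import Data.Fin using (Fin; zero; suc)
import Data.Integer as ℤ
import Data.Integer.Properties as ℤₚ
open import Data.List as List using (List; []; _∷_; _++_; map; allFin; length)
import Data.List.Properties as Listₚ
open import Data.List.Relation.Unary.All using ([]; _∷_)
open import Data.Nat as ℕ using (ℕ; zero; suc; _^_; z≤n; s≤s)
import Data.Nat.Coprimality as Coprimality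
import Data.Nat.Properties as ℕₚ
open import Data.Product using (Σ; _×_; _,_; ∃)
open import Data.Rational
  using ( ℚ; mkℚ; 0ℚ; 1ℚ; ½; _+_; _*_; _-_; -_; _≤_; _<_; ∣_∣; 1/_; ↥_; *≤*; *<*
        ; NonZero; nonNegative; nonPositive; positive)
import Data.Rational.Properties as ℚₚ
open import Data.Rational.Solver using (module +-*-Solver)
open import Data.Sum using (inj₁; inj₂)
open import Data.Vec using (Vec; []; _∷_; zipWith; replicate)
import Data.Vec.Properties as Vecₚ
open import Function using (_∘_; id)
open import Relation.Binary.PropositionalEquality
open import Relation.Nullary using (¬_; yes; no)
open import Relation.Unary using (Decidable)

open +-*-Solver
open CommutativeSemigroupProperties (CommutativeRing.+-commutativeSemigroup 𝔹ₚ.xor-∧-commutativeRing)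
  using () renaming (interchange to xor-interchange)

variable
  A B : Set
  k r : ℕ

-- Exposes the normal form of n / 1, on which the operations of ℚ compute.
ℕtoℚ≡mkℚ : ∀ n → ℕtoℚ n ≡ mkℚ (ℤ.+ n) 0 (Coprimality.sym (Coprimality.1-coprimeTo n))
ℕtoℚ≡mkℚ n = ℚₚ.↥p/↧p≡p (mkℚ (ℤ.+ n) 0 (Coprimality.sym (Coprimality.1-coprimeTo n)))

ℕtoℚ-+ : ∀ m n → ℕtoℚ (m ℕ.+ n) ≡ ℕtoℚ m + ℕtoℚ n
ℕtoℚ-+ m n rewrite ℕtoℚ≡mkℚ m | ℕtoℚ≡mkℚ n =
  ℚₚ./-cong (trans (ℤₚ.pos-+ m n) (sym (cong₂ ℤ._+_ (ℤₚ.*-identityʳ (ℤ.+ m)) (ℤₚ.*-identityʳ (ℤ.+ n))))) refl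

ℕtoℚ-* : ∀ m n → ℕtoℚ (m ℕ.* n) ≡ ℕtoℚ m * ℕtoℚ n
ℕtoℚ-* m n rewrite ℕtoℚ≡mkℚ m | ℕtoℚ≡mkℚ n = ℚₚ./-cong (ℤₚ.pos-* m n) refl

ℕtoℚ-mono-≤ : ∀ {m n} → m ℕ.≤ n → ℕtoℚ m ≤ ℕtoℚ n
ℕtoℚ-mono-≤ {m} {n} m≤n rewrite ℕtoℚ≡mkℚ m | ℕtoℚ≡mkℚ n =
  *≤* (ℤₚ.*-monoʳ-≤-nonNeg (ℤ.+ 1) (ℤ.+≤+ m≤n))

ℕtoℚ-nonNeg : ∀ n → 0ℚ ≤ ℕtoℚ n
ℕtoℚ-nonNeg n = ℕtoℚ-mono-≤ {0} {n} z≤n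

ℕtoℚ-^ : ∀ m n → ℕtoℚ (m ^ n) ≡ powℚ (ℕtoℚ m) n
ℕtoℚ-^ m zero    = refl
ℕtoℚ-^ m (suc n) = trans (ℕtoℚ-* m (m ^ n)) (cong (ℕtoℚ m *_) (ℕtoℚ-^ m n))

powℚ-+ : ∀ a m n → powℚ a (m ℕ.+ n) ≡ powℚ a m * powℚ a n
powℚ-+ a zero    n = sym (ℚₚ.*-identityˡ (powℚ a n))
powℚ-+ a (suc m) n = trans (cong (a *_) (powℚ-+ a m n)) (sym (ℚₚ.*-assoc a (powℚ a m) (powℚ a n)))

powℚ-distribʳ-* : ∀ a b n → powℚ (a * b) n ≡ powℚ a n * powℚ b n
powℚ-distribʳ-* a b zero    = refl
powℚ-distribʳ-* a b (suc n) = trans (cong (a * b *_) (powℚ-distribʳ-* a b n))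
  (solve 4 (λ a b x y → (a :* b) :* (x :* y) := (a :* x) :* (b :* y)) refl a b (powℚ a n) (powℚ b n))

powℚ-1ℚ : ∀ n → powℚ 1ℚ n ≡ 1ℚ
powℚ-1ℚ zero    = refl
powℚ-1ℚ (suc n) = trans (ℚₚ.*-identityˡ (powℚ 1ℚ n)) (powℚ-1ℚ n)

powℚ-nonNeg : ∀ {a} n → 0ℚ ≤ a → 0ℚ ≤ powℚ a n
powℚ-nonNeg zero    0≤a = ℚₚ.≤ᵇ⇒≤ _
powℚ-nonNeg {a} (suc n) 0≤a =
  ℚₚ.nonNegative⁻¹ _
    {{ℚₚ.nonNeg*nonNeg⇒nonNeg a {{nonNegative 0≤a}} (powℚ a n) {{nonNegative (powℚ-nonNeg n 0≤a)}}}}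

powℚ-≤-1 : ∀ {a} n → 0ℚ ≤ a → a ≤ 1ℚ → powℚ a n ≤ 1ℚ
powℚ-≤-1 zero    _   _   = ℚₚ.≤-refl
powℚ-≤-1 {a} (suc n) 0≤a a≤1 = begin
  a * powℚ a n   ≤⟨ ℚₚ.*-monoˡ-≤-nonNeg a {{nonNegative 0≤a}} (powℚ-≤-1 n 0≤a a≤1) ⟩
  a * 1ℚ         ≡⟨ ℚₚ.*-identityʳ a ⟩
  a              ≤⟨ a≤1 ⟩
  1ℚ             ∎
  where open ℚₚ.≤-Reasoning

2^n*½^n≡1 : ∀ n → ℕtoℚ (2 ^ n) * powℚ ½ n ≡ 1ℚ
2^n*½^n≡1 n = begin
  ℕtoℚ (2 ^ n) * powℚ ½ n      ≡⟨ cong (_* powℚ ½ n) (ℕtoℚ-^ 2 n) ⟩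
  powℚ (ℕtoℚ 2) n * powℚ ½ n   ≡⟨ powℚ-distribʳ-* (ℕtoℚ 2) ½ n ⟨
  powℚ 1ℚ n                    ≡⟨ powℚ-1ℚ n ⟩
  1ℚ                           ∎
  where open ≡-Reasoning

2^m*½^[j+m]≡½^j : ∀ j m → ℕtoℚ (2 ^ m) * powℚ ½ (j ℕ.+ m) ≡ powℚ ½ j
2^m*½^[j+m]≡½^j j m = begin
  ℕtoℚ (2 ^ m) * powℚ ½ (j ℕ.+ m)
    ≡⟨ cong (ℕtoℚ (2 ^ m) *_) (powℚ-+ ½ j m) ⟩
  ℕtoℚ (2 ^ m) * (powℚ ½ j * powℚ ½ m)
    ≡⟨ solve 3 (λ a b c → a :* (b :* c) := b :* (a :* c)) refl (ℕtoℚ (2 ^ m)) (powℚ ½ j) (powℚ ½ m) ⟩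
  powℚ ½ j * (ℕtoℚ (2 ^ m) * powℚ ½ m)
    ≡⟨ cong (powℚ ½ j *_) (2^n*½^n≡1 m) ⟩
  powℚ ½ j * 1ℚ
    ≡⟨ ℚₚ.*-identityʳ (powℚ ½ j) ⟩
  powℚ ½ j ∎
  where open ≡-Reasoning

½^[1+n]≤½^n : ∀ n → powℚ ½ (suc n) ≤ powℚ ½ n
½^[1+n]≤½^n n = begin
  ½ * powℚ ½ n
    ≤⟨ ℚₚ.*-monoʳ-≤-nonNeg (powℚ ½ n) {{nonNegative (powℚ-nonNeg {½} n (ℚₚ.≤ᵇ⇒≤ _))}} {½} {1ℚ} (ℚₚ.≤ᵇ⇒≤ _) ⟩
  1ℚ * powℚ ½ n
    ≡⟨ ℚₚ.*-identityˡ (powℚ ½ n) ⟩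
  powℚ ½ n ∎
  where open ℚₚ.≤-Reasoning

½^[1+n]≤½ : ∀ n → powℚ ½ (suc n) ≤ ½
½^[1+n]≤½ n = begin
  ½ * powℚ ½ n   ≤⟨ ℚₚ.*-monoˡ-≤-nonNeg ½ (powℚ-≤-1 n (ℚₚ.≤ᵇ⇒≤ _) (ℚₚ.≤ᵇ⇒≤ _)) ⟩
  ½ * 1ℚ         ≡⟨ ℚₚ.*-identityʳ ½ ⟩
  ½              ∎
  where open ℚₚ.≤-Reasoning

square-nonNeg : ∀ q → 0ℚ ≤ q * q
square-nonNeg q with ℚₚ.≤-total 0ℚ q
... | inj₁ 0≤q = ℚₚ.nonNegative⁻¹ _ {{ℚₚ.nonNeg*nonNeg⇒nonNeg q {{nonNegative 0≤q}} q {{nonNegative 0≤q}}}}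
... | inj₂ q≤0 = ℚₚ.nonNegative⁻¹ _ {{ℚₚ.nonPos*nonPos⇒nonPos q {{nonPositive q≤0}} q {{nonPositive q≤0}}}}

square-pos : ∀ {ε} → 0ℚ < ε → 0ℚ < ε * ε
square-pos {ε} 0<ε = ℚₚ.positive⁻¹ (ε * ε) {{ℚₚ.pos*pos⇒pos ε {{positive 0<ε}} ε {{positive 0<ε}}}}

square-<-self : ∀ {ε} → 0ℚ < ε → ε < 1ℚ → ε * ε < ε
square-<-self {ε} 0<ε ε<1 =
  ℚₚ.<-≤-trans (ℚₚ.*-monoʳ-<-pos ε {{positive 0<ε}} ε<1) (ℚₚ.≤-reflexive (ℚₚ.*-identityʳ ε))

½*μ≤μ-μ*μ : ∀ {μ} → 0ℚ ≤ μ → μ ≤ ½ → ½ * μ ≤ μ - μ * μ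
½*μ≤μ-μ*μ {μ} 0≤μ μ≤½ = begin
  ½ * μ          ≡⟨ ℚₚ.*-comm ½ μ ⟩
  μ * (1ℚ - ½)   ≤⟨ ℚₚ.*-monoˡ-≤-nonNeg μ {{nonNegative 0≤μ}} (ℚₚ.+-monoʳ-≤ 1ℚ (ℚₚ.neg-antimono-≤ μ≤½)) ⟩
  μ * (1ℚ - μ)   ≡⟨ solve 1 (λ μ → μ :* (con 1ℚ :- μ) := μ :- μ :* μ) refl μ ⟩
  μ - μ * μ      ∎
  where open ℚₚ.≤-Reasoning

∑ : List A → (A → ℚ) → ℚ
∑ xs f = sumℚ (map f xs)

infix 5 ∑
syntax ∑ xs (λ x → e) = ∑[ x ∈ xs ] e

∑-++ : (xs ys : List A) (f : A → ℚ) → ∑ (xs ++ ys) f ≡ ∑ xs f + ∑ ys f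
∑-++ []       ys f = sym (ℚₚ.+-identityˡ (∑ ys f))
∑-++ (x ∷ xs) ys f = trans (cong (f x +_) (∑-++ xs ys f)) (sym (ℚₚ.+-assoc (f x) (∑ xs f) (∑ ys f)))

∑-map : (g : A → B) (xs : List A) (f : B → ℚ) → ∑ (map g xs) f ≡ ∑ xs (f ∘ g)
∑-map g xs f = cong sumℚ (sym (Listₚ.map-∘ xs))

∑-cong : (xs : List A) {f g : A → ℚ} → (∀ x → f x ≡ g x) → ∑ xs f ≡ ∑ xs g
∑-cong xs f≗g = cong sumℚ (Listₚ.map-cong f≗g xs)

∑-+ : (xs : List A) (f g : A → ℚ) → ∑[ x ∈ xs ] f x + g x ≡ ∑ xs f + ∑ xs g
∑-+ []       f g = refl
∑-+ (x ∷ xs) f g = trans (cong (f x + g x +_) (∑-+ xs f g))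
  (solve 4 (λ a b c d → (a :+ b) :+ (c :+ d) := (a :+ c) :+ (b :+ d)) refl (f x) (g x) (∑ xs f) (∑ xs g))

∑-- : (xs : List A) (f g : A → ℚ) → ∑[ x ∈ xs ] f x - g x ≡ ∑ xs f - ∑ xs g
∑-- []       f g = refl
∑-- (x ∷ xs) f g = trans (cong (f x - g x +_) (∑-- xs f g))
  (solve 4 (λ a b c d → (a :- b) :+ (c :- d) := (a :+ c) :- (b :+ d)) refl (f x) (g x) (∑ xs f) (∑ xs g))

∑-*ˡ : (xs : List A) (c : ℚ) (f : A → ℚ) → ∑[ x ∈ xs ] c * f x ≡ c * ∑ xs f
∑-*ˡ []       c f = sym (ℚₚ.*-zeroʳ c)
∑-*ˡ (x ∷ xs) c f = trans (cong (c * f x +_) (∑-*ˡ xs c f)) (sym (ℚₚ.*-distribˡ-+ c (f x) (∑ xs f)))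

∑-*ʳ : (xs : List A) (c : ℚ) (f : A → ℚ) → ∑[ x ∈ xs ] f x * c ≡ ∑ xs f * c
∑-*ʳ xs c f = trans (∑-cong xs (λ x → ℚₚ.*-comm (f x) c)) (trans (∑-*ˡ xs c f) (ℚₚ.*-comm c (∑ xs f)))

∑-const : (xs : List A) (c : ℚ) → ∑[ x ∈ xs ] c ≡ ℕtoℚ (length xs) * c
∑-const []       c = sym (ℚₚ.*-zeroˡ c)
∑-const (x ∷ xs) c = begin
  c + (∑[ x ∈ xs ] c)
    ≡⟨ cong (c +_) (∑-const xs c) ⟩
  c + ℕtoℚ (length xs) * c
    ≡⟨ solve 2 (λ c n → c :+ n :* c := (con 1ℚ :+ n) :* c) refl c (ℕtoℚ (length xs)) ⟩
  (1ℚ + ℕtoℚ (length xs)) * c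
    ≡⟨ cong (_* c) (ℕtoℚ-+ 1 (length xs)) ⟨
  ℕtoℚ (length (x ∷ xs)) * c ∎
  where open ≡-Reasoning

∑-0 : (xs : List A) → ∑[ x ∈ xs ] 0ℚ ≡ 0ℚ
∑-0 xs = trans (∑-const xs 0ℚ) (ℚₚ.*-zeroʳ (ℕtoℚ (length xs)))

∑-swap : (xs : List A) (ys : List B) (F : A → B → ℚ) →
         ∑[ x ∈ xs ] ∑[ y ∈ ys ] F x y ≡ ∑[ y ∈ ys ] ∑[ x ∈ xs ] F x y
∑-swap []       ys F = sym (∑-0 ys)
∑-swap (x ∷ xs) ys F =
  trans (cong (∑ ys (F x) +_) (∑-swap xs ys F)) (sym (∑-+ ys (F x) (λ y → ∑[ x ∈ xs ] F x y)))

∑-mono-≤ : (xs : List A) {f g : A → ℚ} → (∀ x → f x ≤ g x) → ∑ xs f ≤ ∑ xs g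
∑-mono-≤ []       f≤g = ℚₚ.≤-refl
∑-mono-≤ (x ∷ xs) f≤g = ℚₚ.+-mono-≤ (f≤g x) (∑-mono-≤ xs f≤g)

-- Orthogonality to low-degree polynomials

∑-square-≤-∑-square-sub : (xs : List A) (h q : A → ℚ) → (∑[ x ∈ xs ] h x * q x) ≡ 0ℚ →
  (∑[ x ∈ xs ] h x * h x) ≤ (∑[ x ∈ xs ] (h x - q x) * (h x - q x))
∑-square-≤-∑-square-sub {A} xs h q ∑hq≡0 = begin
  (∑[ x ∈ xs ] h x * h x)                   ≤⟨ ∑-mono-≤ xs pointwise ⟩
  (∑[ x ∈ xs ] sq x + (hq x + hq x))        ≡⟨ ∑-+ xs sq (λ x → hq x + hq x) ⟩
  ∑ xs sq + (∑[ x ∈ xs ] hq x + hq x)       ≡⟨ cong (∑ xs sq +_) (∑-+ xs hq hq) ⟩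
  ∑ xs sq + (∑ xs hq + ∑ xs hq)             ≡⟨ cong (λ s → ∑ xs sq + (s + s)) ∑hq≡0 ⟩
  ∑ xs sq + 0ℚ                              ≡⟨ ℚₚ.+-identityʳ (∑ xs sq) ⟩
  ∑ xs sq                                   ∎
  where
  open ℚₚ.≤-Reasoning
  sq hq : A → ℚ
  sq x = (h x - q x) * (h x - q x)
  hq x = h x * q x
  expand : ∀ a b → (a - b) * (a - b) + (a * b + a * b) ≡ a * a + b * b
  expand = solve 2 (λ a b → (a :- b) :* (a :- b) :+ (a :* b :+ a :* b) := a :* a :+ b :* b) refl
  pointwise : ∀ x → h x * h x ≤ sq x + (hq x + hq x)
  pointwise x = begin
    h x * h x               ≡⟨ ℚₚ.+-identityʳ (h x * h x) ⟨
    h x * h x + 0ℚ          ≤⟨ ℚₚ.+-monoʳ-≤ (h x * h x) (square-nonNeg (q x)) ⟩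
    h x * h x + q x * q x   ≡⟨ expand (h x) (q x) ⟨
    sq x + (hq x + hq x)    ∎

∑-*-evalPoly≡0 : {k d : ℕ} (xs : List (Cube k)) (h : Cube k → ℚ) →
  (∀ e → monoDeg e ℕ.≤ d → (∑[ x ∈ xs ] h x * evalMono e x) ≡ 0ℚ) →
  (p : Poly k) → DegLE p d → (∑[ x ∈ xs ] h x * evalPoly p x) ≡ 0ℚ
∑-*-evalPoly≡0 xs h orth []            []              = trans (∑-cong xs (λ x → ℚₚ.*-zeroʳ (h x))) (∑-0 xs)
∑-*-evalPoly≡0 xs h orth ((c , e) ∷ p) (deg-e ∷ deg-p) = begin
  (∑[ x ∈ xs ] h x * (c * evalMono e x + evalPoly p x))
    ≡⟨ ∑-cong xs (λ x → distrib (h x) c (evalMono e x) (evalPoly p x)) ⟩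
  (∑[ x ∈ xs ] c * (h x * evalMono e x) + h x * evalPoly p x)
    ≡⟨ ∑-+ xs (λ x → c * (h x * evalMono e x)) (λ x → h x * evalPoly p x) ⟩
  (∑[ x ∈ xs ] c * (h x * evalMono e x)) + (∑[ x ∈ xs ] h x * evalPoly p x)
    ≡⟨ cong₂ _+_ (trans (∑-*ˡ xs c (λ x → h x * evalMono e x)) (cong (c *_) (orth e deg-e)))
                 (∑-*-evalPoly≡0 xs h orth p deg-p) ⟩
  c * 0ℚ + 0ℚ
    ≡⟨ trans (ℚₚ.+-identityʳ (c * 0ℚ)) (ℚₚ.*-zeroʳ c) ⟩
  0ℚ ∎
  where
  open ≡-Reasoning
  distrib : ∀ h c m r → h * (c * m + r) ≡ c * (h * m) + h * r
  distrib = solve 4 (λ h c m r → h :* (c :* m :+ r) := c :* (h :* m) :+ h :* r) refl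

evalMono-zeros : (x : Cube k) → evalMono (replicate k 0) x ≡ 1ℚ
evalMono-zeros []      = refl
evalMono-zeros (b ∷ x) = trans (ℚₚ.*-identityˡ _) (evalMono-zeros x)

monoDeg-zeros : ∀ k → monoDeg (replicate k 0) ≡ 0
monoDeg-zeros zero    = refl
monoDeg-zeros (suc k) = monoDeg-zeros k

countᵇ : (A → Bool) → List A → ℕ
countᵇ p []       = 0
countᵇ p (x ∷ xs) = if p x then suc (countᵇ p xs) else countᵇ p xs

countᵇ-++ : (p : A → Bool) (xs ys : List A) → countᵇ p (xs ++ ys) ≡ countᵇ p xs ℕ.+ countᵇ p ys
countᵇ-++ p []       ys = refl
countᵇ-++ p (x ∷ xs) ys with p x
... | true  = cong suc (countᵇ-++ p xs ys)
... | false = countᵇ-++ p xs ys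

countᵇ-map : (p : B → Bool) (g : A → B) (xs : List A) → countᵇ p (map g xs) ≡ countᵇ (p ∘ g) xs
countᵇ-map p g []       = refl
countᵇ-map p g (x ∷ xs) with p (g x)
... | true  = cong suc (countᵇ-map p g xs)
... | false = countᵇ-map p g xs

countᵇ-+-countᵇ-not : (p : A → Bool) (xs : List A) → countᵇ p xs ℕ.+ countᵇ (not ∘ p) xs ≡ length xs
countᵇ-+-countᵇ-not p []       = refl
countᵇ-+-countᵇ-not p (x ∷ xs) with p x
... | true  = cong suc (countᵇ-+-countᵇ-not p xs)
... | false = trans (ℕₚ.+-suc _ _) (cong suc (countᵇ-+-countᵇ-not p xs))

length-allPoints : ∀ k → length (allPoints k) ≡ 2 ^ k
length-allPoints zero    = refl
length-allPoints (suc k) = begin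
  length (map (false ∷_) P ++ map (true ∷_) P)
    ≡⟨ Listₚ.length-++ (map (false ∷_) P) ⟩
  length (map (false ∷_) P) ℕ.+ length (map (true ∷_) P)
    ≡⟨ cong₂ ℕ._+_ (Listₚ.length-map (false ∷_) P) (Listₚ.length-map (true ∷_) P) ⟩
  length P ℕ.+ length P
    ≡⟨ cong₂ ℕ._+_ (length-allPoints k) (trans (length-allPoints k) (sym (ℕₚ.+-identityʳ (2 ^ k)))) ⟩
  2 ^ suc k ∎
  where
  open ≡-Reasoning
  P = allPoints k

∑-allPoints-suc : (f : Cube (suc k) → ℚ) →
  ∑ (allPoints (suc k)) f ≡ (∑[ x ∈ allPoints k ] f (false ∷ x)) + (∑[ x ∈ allPoints k ] f (true ∷ x))
∑-allPoints-suc {k} f = trans (∑-++ (map (false ∷_) (allPoints k)) _ f)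
  (cong₂ _+_ (∑-map (false ∷_) (allPoints k) f) (∑-map (true ∷_) (allPoints k) f))

countᵇ-allPoints-suc : (p : Cube (suc k) → Bool) →
  countᵇ p (allPoints (suc k))
    ≡ countᵇ (p ∘ (false ∷_)) (allPoints k) ℕ.+ countᵇ (p ∘ (true ∷_)) (allPoints k)
countᵇ-allPoints-suc {k} p = trans (countᵇ-++ p (map (false ∷_) (allPoints k)) _)
  (cong₂ ℕ._+_ (countᵇ-map p (false ∷_) (allPoints k)) (countᵇ-map p (true ∷_) (allPoints k)))

-- Characters of F₂ʳ

infixl 6 _⊕_
_⊕_ : Vec Bool r → Vec Bool r → Vec Bool r
_⊕_ = zipWith _xor_

infix 7 _·_
_·_ : Vec Bool r → Vec Bool r → Bool
[]       · []       = false
(a ∷ as) · (b ∷ bs) = (a ∧ b) xor (as · bs)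

isZero : Vec Bool r → Bool
isZero []      = true
isZero (b ∷ v) = not b ∧ isZero v

⊕-identityʳ : (v : Vec Bool r) → v ⊕ replicate r false ≡ v
⊕-identityʳ = Vecₚ.zipWith-identityʳ 𝔹ₚ.xor-identityʳ

⊕-cancelˡ : (u w : Vec Bool r) → u ⊕ (u ⊕ w) ≡ w
⊕-cancelˡ []       []       = refl
⊕-cancelˡ (a ∷ u) (b ∷ w) = cong₂ _∷_ (xor-cancelˡ a) (⊕-cancelˡ u w)
  where
  xor-cancelˡ : ∀ a → a xor (a xor b) ≡ b
  xor-cancelˡ false = refl
  xor-cancelˡ true  = 𝔹ₚ.not-involutive b

⊕-leftComm : (u v w : Vec Bool r) → u ⊕ (v ⊕ w) ≡ v ⊕ (u ⊕ w)
⊕-leftComm u v w = begin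
  u ⊕ (v ⊕ w)   ≡⟨ Vecₚ.zipWith-assoc 𝔹ₚ.xor-assoc u v w ⟨
  (u ⊕ v) ⊕ w   ≡⟨ cong (_⊕ w) (Vecₚ.zipWith-comm 𝔹ₚ.xor-comm u v) ⟩
  (v ⊕ u) ⊕ w   ≡⟨ Vecₚ.zipWith-assoc 𝔹ₚ.xor-assoc v u w ⟩
  v ⊕ (u ⊕ w)   ∎
  where open ≡-Reasoning

·-distribˡ-⊕ : (a u w : Vec Bool r) → a · (u ⊕ w) ≡ (a · u) xor (a · w)
·-distribˡ-⊕ []       []       []       = refl
·-distribˡ-⊕ (a ∷ as) (b ∷ u) (c ∷ w) = begin
  (a ∧ (b xor c)) xor (as · (u ⊕ w))
    ≡⟨ cong₂ _xor_ (𝔹ₚ.∧-distribˡ-xor a b c) (·-distribˡ-⊕ as u w) ⟩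
  ((a ∧ b) xor (a ∧ c)) xor ((as · u) xor (as · w))
    ≡⟨ xor-interchange (a ∧ b) (a ∧ c) (as · u) (as · w) ⟩
  ((a ∧ b) xor (as · u)) xor ((a ∧ c) xor (as · w)) ∎
  where open ≡-Reasoning

·-isZeroˡ : (a s : Vec Bool r) → isZero a ≡ true → a · s ≡ false
·-isZeroˡ []          []      _ = refl
·-isZeroˡ (false ∷ a) (_ ∷ s) a≡0 = ·-isZeroˡ a s a≡0

·-isZeroʳ : (a s : Vec Bool r) → isZero s ≡ true → a · s ≡ false
·-isZeroʳ []      []          _ = refl
·-isZeroʳ (b ∷ a) (false ∷ s) s≡0 = cong₂ _xor_ (𝔹ₚ.∧-zeroʳ b) (·-isZeroʳ a s s≡0)

sign : Bool → ℚ
sign false = 1ℚ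
sign true  = - 1ℚ

sign-xor : ∀ p q → sign (p xor q) ≡ sign p * sign q
sign-xor false q     = sym (ℚₚ.*-identityˡ (sign q))
sign-xor true  false = refl
sign-xor true  true  = refl

sign-+-sign-not : ∀ p → sign p + sign (not p) ≡ 0ℚ
sign-+-sign-not false = refl
sign-+-sign-not true  = refl

∑-isZero-⊕ : (s : Vec Bool r) → ∑[ v ∈ allPoints r ] bit (isZero (v ⊕ s)) ≡ 1ℚ
∑-isZero-⊕ []          = refl
∑-isZero-⊕ {suc r} (false ∷ s) = trans (∑-allPoints-suc (λ v → bit (isZero (v ⊕ (false ∷ s)))))
  (cong₂ _+_ (∑-isZero-⊕ s) (∑-0 (allPoints r)))
∑-isZero-⊕ {suc r} (true ∷ s) = trans (∑-allPoints-suc (λ v → bit (isZero (v ⊕ (true ∷ s)))))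
  (trans (cong₂ _+_ (∑-0 (allPoints r)) (∑-isZero-⊕ s)) (ℚₚ.+-identityˡ 1ℚ))

∑-isZero : ∀ r → ∑[ a ∈ allPoints r ] bit (isZero a) ≡ 1ℚ
∑-isZero r = trans (∑-cong (allPoints r) (λ a → cong (bit ∘ isZero) (sym (⊕-identityʳ a))))
  (∑-isZero-⊕ (replicate r false))

∑-sign-· : (s : Vec Bool r) → isZero s ≡ false → ∑[ a ∈ allPoints r ] sign (a · s) ≡ 0ℚ
∑-sign-· []          ()
∑-sign-· {suc r} (false ∷ s) s≢0 = begin
  (∑[ a ∈ allPoints (suc r) ] sign (a · (false ∷ s)))
    ≡⟨ ∑-allPoints-suc (λ a → sign (a · (false ∷ s))) ⟩
  (∑[ a ∈ V ] sign (a · s)) + (∑[ a ∈ V ] sign (a · s))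
    ≡⟨ cong₂ _+_ (∑-sign-· s s≢0) (∑-sign-· s s≢0) ⟩
  0ℚ ∎
  where
  open ≡-Reasoning
  V = allPoints r
∑-sign-· {suc r} (true ∷ s) _ = begin
  (∑[ a ∈ allPoints (suc r) ] sign (a · (true ∷ s)))
    ≡⟨ ∑-allPoints-suc (λ a → sign (a · (true ∷ s))) ⟩
  (∑[ a ∈ V ] sign (a · s)) + (∑[ a ∈ V ] sign (not (a · s)))
    ≡⟨ ∑-+ V (λ a → sign (a · s)) (λ a → sign (not (a · s))) ⟨
  (∑[ a ∈ V ] sign (a · s) + sign (not (a · s)))
    ≡⟨ ∑-cong V (λ a → sign-+-sign-not (a · s)) ⟩
  (∑[ a ∈ V ] 0ℚ)
    ≡⟨ ∑-0 V ⟩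
  0ℚ ∎
  where
  open ≡-Reasoning
  V = allPoints r

bit-isZero-fourier : (s : Vec Bool r) → bit (isZero s) ≡ powℚ ½ r * (∑[ a ∈ allPoints r ] sign (a · s))
bit-isZero-fourier {r} s with isZero s in s≡0
... | false = sym (trans (cong (powℚ ½ r *_) (∑-sign-· s s≡0)) (ℚₚ.*-zeroʳ (powℚ ½ r)))
... | true  = sym (begin
  powℚ ½ r * (∑[ a ∈ allPoints r ] sign (a · s))
    ≡⟨ cong (powℚ ½ r *_) (∑-cong (allPoints r) (λ a → cong sign (·-isZeroʳ a s s≡0))) ⟩
  powℚ ½ r * (∑[ a ∈ allPoints r ] 1ℚ)
    ≡⟨ cong (powℚ ½ r *_) (∑-const (allPoints r) 1ℚ) ⟩
  powℚ ½ r * (ℕtoℚ (length (allPoints r)) * 1ℚ)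
    ≡⟨ cong (λ m → powℚ ½ r * (ℕtoℚ m * 1ℚ)) (length-allPoints r) ⟩
  powℚ ½ r * (ℕtoℚ (2 ^ r) * 1ℚ)
    ≡⟨ cong (powℚ ½ r *_) (ℚₚ.*-identityʳ (ℕtoℚ (2 ^ r))) ⟩
  powℚ ½ r * ℕtoℚ (2 ^ r)
    ≡⟨ ℚₚ.*-comm (powℚ ½ r) (ℕtoℚ (2 ^ r)) ⟩
  ℕtoℚ (2 ^ r) * powℚ ½ r
    ≡⟨ 2^n*½^n≡1 r ⟩
  1ℚ ∎)
  where open ≡-Reasoning

-- The code

syndrome : (vs : List (Vec Bool r)) → Cube (length vs) → Vec Bool r
syndrome {r} []       []          = replicate r false
syndrome     (v ∷ vs) (false ∷ x) = syndrome vs x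
syndrome     (v ∷ vs) (true ∷ x)  = v ⊕ syndrome vs x

χ : (vs : List (Vec Bool r)) → Vec Bool r → Cube (length vs) → ℚ
χ vs a x = sign (a · syndrome vs x)

∑-χ*evalMono-∷ : (v : Vec Bool r) (vs : List (Vec Bool r)) (a : Vec Bool r) (i : ℕ) (e : Vec ℕ (length vs)) →
  ∑[ x ∈ allPoints (length (v ∷ vs)) ] χ (v ∷ vs) a x * evalMono (i ∷ e) x
    ≡ (powℚ 0ℚ i + sign (a · v) * powℚ 1ℚ i) * (∑[ x ∈ allPoints (length vs) ] χ vs a x * evalMono e x)
∑-χ*evalMono-∷ v vs a i e = begin
  (∑[ x ∈ allPoints (suc (length vs)) ] χ (v ∷ vs) a x * evalMono (i ∷ e) x)
    ≡⟨ ∑-allPoints-suc (λ x → χ (v ∷ vs) a x * evalMono (i ∷ e) x) ⟩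
  (∑[ x ∈ X ] χ vs a x * (p₀ * m x)) + (∑[ x ∈ X ] sign (a · (v ⊕ syndrome vs x)) * (p₁ * m x))
    ≡⟨ cong₂ _+_ (∑-cong X (λ x → reorder (χ vs a x) p₀ (m x)))
                 (∑-cong X (λ x → trans (cong (_* (p₁ * m x)) (χ-true x))
                                        (reorder′ (sign (a · v)) (χ vs a x) p₁ (m x)))) ⟩
  (∑[ x ∈ X ] p₀ * (χ vs a x * m x)) + (∑[ x ∈ X ] (sign (a · v) * p₁) * (χ vs a x * m x))
    ≡⟨ cong₂ _+_ (∑-*ˡ X p₀ (λ x → χ vs a x * m x)) (∑-*ˡ X (sign (a · v) * p₁) (λ x → χ vs a x * m x)) ⟩
  p₀ * T + (sign (a · v) * p₁) * T
    ≡⟨ ℚₚ.*-distribʳ-+ T p₀ (sign (a · v) * p₁) ⟨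
  (p₀ + sign (a · v) * p₁) * T ∎
  where
  open ≡-Reasoning
  X = allPoints (length vs)
  m = evalMono e
  p₀ = powℚ 0ℚ i
  p₁ = powℚ 1ℚ i
  T = ∑[ x ∈ X ] χ vs a x * m x
  χ-true : ∀ x → sign (a · (v ⊕ syndrome vs x)) ≡ sign (a · v) * χ vs a x
  χ-true x = trans (cong sign (·-distribˡ-⊕ a v (syndrome vs x))) (sign-xor (a · v) (a · syndrome vs x))
  reorder : ∀ c p y → c * (p * y) ≡ p * (c * y)
  reorder = solve 3 (λ c p y → c :* (p :* y) := p :* (c :* y)) refl
  reorder′ : ∀ s c p y → (s * c) * (p * y) ≡ (s * p) * (c * y)
  reorder′ = solve 4 (λ s c p y → (s :* c) :* (p :* y) := (s :* p) :* (c :* y)) refl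

-- A column v with a · v = 1 whose variable is absent from the monomial contributes the factor
-- 1 + (-1) = 0, and the weight hypothesis leaves the monomial too few variables to avoid them all.
∑-χ*evalMono≡0 : (vs : List (Vec Bool r)) (a : Vec Bool r) (e : Vec ℕ (length vs)) →
  monoDeg e ℕ.< countᵇ (a ·_) vs → ∑[ x ∈ allPoints (length vs) ] χ vs a x * evalMono e x ≡ 0ℚ
∑-χ*evalMono≡0 []       a []      ()
∑-χ*evalMono≡0 (v ∷ vs) a (i ∷ e) deg< = trans (∑-χ*evalMono-∷ v vs a i e) (factor-or-rest (a · v) i deg<)
  where
  T = ∑[ x ∈ allPoints (length vs) ] χ vs a x * evalMono e x
  rest≡0 : monoDeg e ℕ.< countᵇ (a ·_) vs → ∀ c → c * T ≡ 0ℚ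
  rest≡0 h c = trans (cong (c *_) (∑-χ*evalMono≡0 vs a e h)) (ℚₚ.*-zeroʳ c)
  factor : Bool → ℕ → ℚ
  factor b i = powℚ 0ℚ i + sign b * powℚ 1ℚ i
  factor-or-rest : ∀ b i → i ℕ.+ monoDeg e ℕ.< (if b then suc (countᵇ (a ·_) vs) else countᵇ (a ·_) vs) →
    factor b i * T ≡ 0ℚ
  factor-or-rest true  zero    _ = ℚₚ.*-zeroˡ T
  factor-or-rest true  (suc i) h =
    rest≡0 (ℕₚ.≤-<-trans (ℕₚ.m≤n+m (monoDeg e) i) (ℕₚ.≤-pred h)) (factor true (suc i))
  factor-or-rest false i       h = rest≡0 (ℕₚ.≤-<-trans (ℕₚ.m≤n+m (monoDeg e) i) h) (factor false i)

syndrome-flipAt : (vs : List (Vec Bool r)) (x : Cube (length vs)) (i : Fin (length vs)) →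
  syndrome vs (flipAt x i) ≡ List.lookup vs i ⊕ syndrome vs x
syndrome-flipAt (v ∷ vs) (false ∷ x) zero    = refl
syndrome-flipAt (v ∷ vs) (true ∷ x)  zero    = sym (⊕-cancelˡ v (syndrome vs x))
syndrome-flipAt (v ∷ vs) (false ∷ x) (suc i) = syndrome-flipAt vs x i
syndrome-flipAt (v ∷ vs) (true ∷ x)  (suc i) =
  trans (cong (v ⊕_) (syndrome-flipAt vs x i)) (⊕-leftComm v (List.lookup vs i) (syndrome vs x))

countᵇ-·-allPoints : ∀ n (a : Vec Bool (suc n)) → isZero a ≡ false → countᵇ (a ·_) (allPoints (suc n)) ≡ 2 ^ n
countᵇ-·-allPoints zero    (false ∷ []) ()
countᵇ-·-allPoints zero    (true ∷ [])  _ = refl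
countᵇ-·-allPoints (suc n) (b ∷ a) a≢0 = trans (countᵇ-allPoints-suc ((b ∷ a) ·_)) (halves b a≢0)
  where
  P = allPoints (suc n)
  halves : ∀ b → isZero (b ∷ a) ≡ false →
    countᵇ (λ v → (b ∧ false) xor (a · v)) P ℕ.+ countᵇ (λ v → (b ∧ true) xor (a · v)) P ≡ 2 ^ suc n
  halves false a≢0 = cong₂ ℕ._+_ (countᵇ-·-allPoints n a a≢0)
    (trans (countᵇ-·-allPoints n a a≢0) (sym (ℕₚ.+-identityʳ (2 ^ n))))
  halves true  _   = trans (countᵇ-+-countᵇ-not (a ·_) P) (length-allPoints (suc n))

codeLength : ℕ → ℕ
codeLength r = length (allPoints r)

isCodeword : (r : ℕ) → Cube (codeLength r) → Bool
isCodeword r x = isZero (syndrome (allPoints r) x)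

nonCodeword : (r : ℕ) → Cube (codeLength r) → ℚ
nonCodeword r x = bit (not (isCodeword r x))

∑-χ*evalMono-allPoints : ∀ n (a : Vec Bool (suc n)) (e : Vec ℕ (codeLength (suc n))) → monoDeg e ℕ.< 2 ^ n →
  ∑[ x ∈ allPoints (codeLength (suc n)) ] χ (allPoints (suc n)) a x * evalMono e x
    ≡ bit (isZero a) * (∑[ x ∈ allPoints (codeLength (suc n)) ] evalMono e x)
∑-χ*evalMono-allPoints n a e deg< with isZero a in a≡0
... | true  =
  trans (∑-cong X (λ x → cong (λ b → sign b * evalMono e x) (·-isZeroˡ a _ a≡0))) (∑-*ˡ X 1ℚ (evalMono e))
  where X = allPoints (codeLength (suc n))
... | false =
  trans (∑-χ*evalMono≡0 (allPoints (suc n)) a e (subst (monoDeg e ℕ.<_) (sym (countᵇ-·-allPoints n a a≡0)) deg<))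
        (sym (ℚₚ.*-zeroˡ (∑ (allPoints (codeLength (suc n))) (evalMono e))))

∑-codeword*evalMono : ∀ n (e : Vec ℕ (codeLength (suc n))) → monoDeg e ℕ.< 2 ^ n →
  ∑[ x ∈ allPoints (codeLength (suc n)) ] bit (isCodeword (suc n) x) * evalMono e x
    ≡ powℚ ½ (suc n) * (∑[ x ∈ allPoints (codeLength (suc n)) ] evalMono e x)
∑-codeword*evalMono n e deg< = begin
  ∑[ x ∈ X ] bit (isCodeword (suc n) x) * m x
    ≡⟨ ∑-cong X (λ x → cong (_* m x) (bit-isZero-fourier (syndrome V x))) ⟩
  ∑[ x ∈ X ] (μ * (∑[ a ∈ V ] χ V a x)) * m x
    ≡⟨ ∑-cong X (λ x → trans (ℚₚ.*-assoc μ _ (m x)) (cong (μ *_) (sym (∑-*ʳ V (m x) (λ a → χ V a x))))) ⟩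
  ∑[ x ∈ X ] μ * (∑[ a ∈ V ] χ V a x * m x)
    ≡⟨ ∑-*ˡ X μ (λ x → ∑[ a ∈ V ] χ V a x * m x) ⟩
  μ * (∑[ x ∈ X ] ∑[ a ∈ V ] χ V a x * m x)
    ≡⟨ cong (μ *_) (∑-swap X V (λ x a → χ V a x * m x)) ⟩
  μ * (∑[ a ∈ V ] ∑[ x ∈ X ] χ V a x * m x)
    ≡⟨ cong (μ *_) (∑-cong V (λ a → ∑-χ*evalMono-allPoints n a e deg<)) ⟩
  μ * (∑[ a ∈ V ] bit (isZero a) * M)
    ≡⟨ cong (μ *_) (∑-*ʳ V M (bit ∘ isZero)) ⟩
  μ * ((∑[ a ∈ V ] bit (isZero a)) * M)
    ≡⟨ cong (λ c → μ * (c * M)) (∑-isZero (suc n)) ⟩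
  μ * (1ℚ * M)
    ≡⟨ cong (μ *_) (ℚₚ.*-identityˡ M) ⟩
  μ * M ∎
  where
  open ≡-Reasoning
  V = allPoints (suc n)
  X = allPoints (codeLength (suc n))
  μ = powℚ ½ (suc n)
  m = evalMono e
  M = ∑ X m

-- Self-bounding

hamming≡0⇒≡ : (x y : Vec Bool k) → hamming x y ≡ 0 → x ≡ y
hamming≡0⇒≡ []          []          _  = refl
hamming≡0⇒≡ (false ∷ x) (false ∷ y) eq = cong (false ∷_) (hamming≡0⇒≡ x y eq)
hamming≡0⇒≡ (true ∷ x)  (true ∷ y)  eq = cong (true ∷_) (hamming≡0⇒≡ x y eq)
hamming≡0⇒≡ (false ∷ x) (true ∷ y)  ()
hamming≡0⇒≡ (true ∷ x)  (false ∷ y) ()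

∣bit-bit∣≤1 : ∀ b c → ∣ bit b - bit c ∣ ≤ 1ℚ
∣bit-bit∣≤1 false false = ℚₚ.≤ᵇ⇒≤ _
∣bit-bit∣≤1 false true  = ℚₚ.≤-refl
∣bit-bit∣≤1 true  false = ℚₚ.≤-refl
∣bit-bit∣≤1 true  true  = ℚₚ.≤ᵇ⇒≤ _

bit∘-Lipschitz1 : (φ : Cube k → Bool) → Lipschitz1 (bit ∘ φ)
bit∘-Lipschitz1 φ x y with hamming x y in eq
... | zero  rewrite hamming≡0⇒≡ x y eq = ℚₚ.≤-reflexive (cong ∣_∣ (ℚₚ.+-inverseʳ (bit (φ y))))
... | suc m = ℚₚ.≤-trans (∣bit-bit∣≤1 (φ x) (φ y)) (ℕtoℚ-mono-≤ {1} {suc m} (s≤s z≤n))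

∑-allFin-lookup : (xs : List A) (f : A → ℚ) → (∑[ i ∈ allFin (length xs) ] f (List.lookup xs i)) ≡ ∑ xs f
∑-allFin-lookup xs f = trans (sym (∑-map (List.lookup xs) (allFin (length xs)) f))
  (cong (λ ys → ∑ ys f) (trans (Listₚ.map-tabulate id (List.lookup xs)) (Listₚ.tabulate-lookup xs)))

pos-bit-not-sub : ∀ z w → pos (bit (not z) - bit (not w)) ≡ bit (not z) * bit w
pos-bit-not-sub false false = refl
pos-bit-not-sub false true  = refl
pos-bit-not-sub true  false = refl
pos-bit-not-sub true  true  = refl

∑-nonCodeword-drop : ∀ r (x : Cube (codeLength r)) →
  (∑[ i ∈ allFin (codeLength r) ] pos (nonCodeword r x - nonCodeword r (flipAt x i))) ≡ nonCodeword r x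
∑-nonCodeword-drop r x = begin
  (∑[ i ∈ allFin (codeLength r) ] pos (nonCodeword r x - nonCodeword r (flipAt x i)))
    ≡⟨ ∑-cong (allFin (codeLength r)) (λ i → cong (λ s → pos (f - bit (not (isZero s)))) (syndrome-flipAt V x i)) ⟩
  (∑[ i ∈ allFin (codeLength r) ] pos (f - bit (not (isZero (List.lookup V i ⊕ s)))))
    ≡⟨ ∑-allFin-lookup V (λ v → pos (f - bit (not (isZero (v ⊕ s))))) ⟩
  (∑[ v ∈ V ] pos (f - bit (not (isZero (v ⊕ s)))))
    ≡⟨ ∑-cong V (λ v → pos-bit-not-sub (isZero s) (isZero (v ⊕ s))) ⟩
  (∑[ v ∈ V ] f * bit (isZero (v ⊕ s)))
    ≡⟨ ∑-*ˡ V f (λ v → bit (isZero (v ⊕ s))) ⟩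
  f * (∑[ v ∈ V ] bit (isZero (v ⊕ s)))
    ≡⟨ cong (f *_) (∑-isZero-⊕ s) ⟩
  f * 1ℚ
    ≡⟨ ℚₚ.*-identityʳ f ⟩
  f ∎
  where
  open ≡-Reasoning
  V = allPoints r
  s = syndrome V x
  f = nonCodeword r x

nonCodeword-selfBounding : ∀ r → SelfBounding (nonCodeword r)
nonCodeword-selfBounding r =
  bit∘-Lipschitz1 (not ∘ isCodeword r) , λ x → ℚₚ.≤-reflexive (∑-nonCodeword-drop r x)

bit-∈[0,1] : ∀ b → 0ℚ ≤ bit b × bit b ≤ 1ℚ
bit-∈[0,1] false = ℚₚ.≤-refl , ℚₚ.≤ᵇ⇒≤ _
bit-∈[0,1] true  = ℚₚ.≤ᵇ⇒≤ _ , ℚₚ.≤-refl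

-- Approximation in ℓ₂

sub-bit-square : ∀ μ b → (μ - bit b) * (μ - bit b) ≡ (μ + μ - 1ℚ) * (μ - bit b) + (μ - μ * μ)
sub-bit-square μ false =
  solve 1 (λ μ → (μ :- con 0ℚ) :* (μ :- con 0ℚ) := (μ :+ μ :- con 1ℚ) :* (μ :- con 0ℚ) :+ (μ :- μ :* μ)) refl μ
sub-bit-square μ true  =
  solve 1 (λ μ → (μ :- con 1ℚ) :* (μ :- con 1ℚ) := (μ :+ μ :- con 1ℚ) :* (μ :- con 1ℚ) :+ (μ :- μ :* μ)) refl μ

bit-not-sub : ∀ μ b p → bit (not b) - p ≡ (μ - bit b) - ((μ - 1ℚ) + p)
bit-not-sub μ false p = solve 2 (λ μ p → con 1ℚ :- p := (μ :- con 0ℚ) :- ((μ :- con 1ℚ) :+ p)) refl μ p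
bit-not-sub μ true  p = solve 2 (λ μ p → con 0ℚ :- p := (μ :- con 1ℚ) :- ((μ :- con 1ℚ) :+ p)) refl μ p

module _ (n : ℕ) where
  private
    X : List (Cube (codeLength (suc n)))
    X = allPoints (codeLength (suc n))
    μ : ℚ
    μ = powℚ ½ (suc n)
    G : Cube (codeLength (suc n)) → ℚ
    G x = bit (isCodeword (suc n) x)

  centred : Cube (codeLength (suc n)) → ℚ
  centred x = μ - G x

  ∑-centred*evalMono≡0 : (e : Vec ℕ (codeLength (suc n))) → monoDeg e ℕ.< 2 ^ n →
    (∑[ x ∈ X ] centred x * evalMono e x) ≡ 0ℚ
  ∑-centred*evalMono≡0 e deg< = begin
    (∑[ x ∈ X ] centred x * m x)
      ≡⟨ ∑-cong X (λ x → distribʳ μ (G x) (m x)) ⟩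
    (∑[ x ∈ X ] μ * m x - G x * m x)
      ≡⟨ ∑-- X (λ x → μ * m x) (λ x → G x * m x) ⟩
    (∑[ x ∈ X ] μ * m x) - (∑[ x ∈ X ] G x * m x)
      ≡⟨ cong₂ _-_ (∑-*ˡ X μ m) (∑-codeword*evalMono n e deg<) ⟩
    μ * ∑ X m - μ * ∑ X m
      ≡⟨ ℚₚ.+-inverseʳ (μ * ∑ X m) ⟩
    0ℚ ∎
    where
    open ≡-Reasoning
    m = evalMono e
    distribʳ : ∀ a b y → (a - b) * y ≡ a * y - b * y
    distribʳ = solve 3 (λ a b y → (a :- b) :* y := a :* y :- b :* y) refl

  ∑-centred*evalPoly≡0 : {d : ℕ} → d ℕ.< 2 ^ n → (p : Poly (codeLength (suc n))) → DegLE p d →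
    (∑[ x ∈ X ] centred x * evalPoly p x) ≡ 0ℚ
  ∑-centred*evalPoly≡0 d< =
    ∑-*-evalPoly≡0 X centred (λ e deg-e → ∑-centred*evalMono≡0 e (ℕₚ.≤-<-trans deg-e d<))

  ∑-centred≡0 : ∑ X centred ≡ 0ℚ
  ∑-centred≡0 = trans
    (∑-cong X (λ x → sym (trans (cong (centred x *_) (evalMono-zeros x)) (ℚₚ.*-identityʳ (centred x)))))
    (∑-centred*evalMono≡0 (replicate _ 0)
      (subst (ℕ._< 2 ^ n) (sym (monoDeg-zeros (codeLength (suc n)))) (ℕₚ.m^n>0 2 n)))

  ∑-centred² : (∑[ x ∈ X ] centred x * centred x) ≡ ℕtoℚ (2 ^ codeLength (suc n)) * (μ - μ * μ)
  ∑-centred² = begin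
    (∑[ x ∈ X ] centred x * centred x)
      ≡⟨ ∑-cong X (λ x → sub-bit-square μ (isCodeword (suc n) x)) ⟩
    (∑[ x ∈ X ] c * centred x + (μ - μ * μ))
      ≡⟨ ∑-+ X (λ x → c * centred x) (λ _ → μ - μ * μ) ⟩
    (∑[ x ∈ X ] c * centred x) + (∑[ x ∈ X ] μ - μ * μ)
      ≡⟨ cong₂ _+_ (∑-*ˡ X c centred) (∑-const X (μ - μ * μ)) ⟩
    c * ∑ X centred + ℕtoℚ (length X) * (μ - μ * μ)
      ≡⟨ cong₂ (λ s m → c * s + ℕtoℚ m * (μ - μ * μ)) ∑-centred≡0 (length-allPoints (codeLength (suc n))) ⟩
    c * 0ℚ + ℕtoℚ (2 ^ codeLength (suc n)) * (μ - μ * μ)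
      ≡⟨ cong (_+ ℕtoℚ (2 ^ codeLength (suc n)) * (μ - μ * μ)) (ℚₚ.*-zeroʳ c) ⟩
    0ℚ + ℕtoℚ (2 ^ codeLength (suc n)) * (μ - μ * μ)
      ≡⟨ ℚₚ.+-identityˡ (ℕtoℚ (2 ^ codeLength (suc n)) * (μ - μ * μ)) ⟩
    ℕtoℚ (2 ^ codeLength (suc n)) * (μ - μ * μ) ∎
    where
    open ≡-Reasoning
    c = μ + μ - 1ℚ

  -- f - p = centred - q, where q = p - (1 - μ) again has degree < 2ⁿ.
  ∑-nonCodeword-sub-evalPoly² : {d : ℕ} → d ℕ.< 2 ^ n → (p : Poly (codeLength (suc n))) → DegLE p d →
    ℕtoℚ (2 ^ codeLength (suc n)) * (μ - μ * μ)
      ≤ (∑[ x ∈ X ] (nonCodeword (suc n) x - evalPoly p x) * (nonCodeword (suc n) x - evalPoly p x))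
  ∑-nonCodeword-sub-evalPoly² d< p deg-p = begin
    ℕtoℚ (2 ^ codeLength (suc n)) * (μ - μ * μ)
      ≡⟨ ∑-centred² ⟨
    (∑[ x ∈ X ] centred x * centred x)
      ≤⟨ ∑-square-≤-∑-square-sub X centred q ∑-centred*q≡0 ⟩
    (∑[ x ∈ X ] (centred x - q x) * (centred x - q x))
      ≡⟨ ∑-cong X (λ x → cong (λ t → t * t) (bit-not-sub μ (isCodeword (suc n) x) (P x))) ⟨
    (∑[ x ∈ X ] (nonCodeword (suc n) x - P x) * (nonCodeword (suc n) x - P x)) ∎
    where
    open ℚₚ.≤-Reasoning
    P = evalPoly p
    q : Cube (codeLength (suc n)) → ℚ
    q x = (μ - 1ℚ) + P x
    distrib : ∀ h c y → h * (c + y) ≡ c * h + h * y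
    distrib = solve 3 (λ h c y → h :* (c :+ y) := c :* h :+ h :* y) refl
    ∑-centred*q≡0 : (∑[ x ∈ X ] centred x * q x) ≡ 0ℚ
    ∑-centred*q≡0 = begin-equality
      (∑[ x ∈ X ] centred x * q x)
        ≡⟨ ∑-cong X (λ x → distrib (centred x) (μ - 1ℚ) (P x)) ⟩
      (∑[ x ∈ X ] (μ - 1ℚ) * centred x + centred x * P x)
        ≡⟨ ∑-+ X (λ x → (μ - 1ℚ) * centred x) (λ x → centred x * P x) ⟩
      (∑[ x ∈ X ] (μ - 1ℚ) * centred x) + (∑[ x ∈ X ] centred x * P x)
        ≡⟨ cong₂ _+_ (trans (∑-*ˡ X (μ - 1ℚ) centred) (cong ((μ - 1ℚ) *_) ∑-centred≡0))
                     (∑-centred*evalPoly≡0 d< p deg-p) ⟩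
      (μ - 1ℚ) * 0ℚ + 0ℚ
        ≡⟨ trans (ℚₚ.+-identityʳ _) (ℚₚ.*-zeroʳ (μ - 1ℚ)) ⟩
      0ℚ ∎

  approxDegLE-nonCodeword : (ε : ℚ) {d : ℕ} → ε * ε < powℚ ½ (2 ℕ.+ n) →
    ApproxDegLE (nonCodeword (suc n)) ε d → 2 ^ n ℕ.≤ d
  approxDegLE-nonCodeword ε ε²< (p , deg-p , close) = ℕₚ.≮⇒≥ λ d<2^n → ℚₚ.<-irrefl refl (begin-strict
    ε * ε
      <⟨ ε²< ⟩
    ½ * μ
      ≤⟨ ½*μ≤μ-μ*μ (powℚ-nonNeg {½} (suc n) (ℚₚ.≤ᵇ⇒≤ _)) (½^[1+n]≤½ n) ⟩
    μ - μ * μ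
      ≤⟨ ℚₚ.*-cancelˡ-≤-pos N {{positive 0<N}} (ℚₚ.≤-trans (∑-nonCodeword-sub-evalPoly² d<2^n p deg-p) close) ⟩
    ε * ε ∎)
    where
    open ℚₚ.≤-Reasoning
    N = ℕtoℚ (2 ^ codeLength (suc n))
    0<N : 0ℚ < N
    0<N = ℚₚ.<-≤-trans (ℚₚ.positive⁻¹ 1ℚ) (ℕtoℚ-mono-≤ (ℕₚ.m^n>0 2 (codeLength (suc n))))

-- Choice of the scale

first-crossing : {P : ℕ → Set} → Decidable P → ¬ P 0 → ∀ m → P m → ∃ λ n → ¬ P n × P (suc n)
first-crossing P? ¬P0 zero    P0 = ⊥-elim (¬P0 P0)
first-crossing P? ¬P0 (suc m) P[1+m] with P? m
... | yes Pm = first-crossing P? ¬P0 m Pm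
... | no ¬Pm = m , ¬Pm , P[1+m]

n<2^n : ∀ n → n ℕ.< 2 ^ n
n<2^n zero    = s≤s z≤n
n<2^n (suc n) = ℕₚ.+-mono-≤ (ℕₚ.m^n>0 2 n) (subst (suc n ℕ.≤_) (sym (ℕₚ.+-identityʳ (2 ^ n))) (n<2^n n))

≤ℕtoℚ∣↥∣ : ∀ q → q ≤ ℕtoℚ ℤ.∣ ↥ q ∣
≤ℕtoℚ∣↥∣ (mkℚ z d _) rewrite ℕtoℚ≡mkℚ ℤ.∣ z ∣ = *≤* (begin
  z ℤ.* ℤ.+ 1                   ≡⟨ ℤₚ.*-identityʳ z ⟩
  z                              ≤⟨ i≤+∣i∣ z ⟩
  ℤ.+ ℤ.∣ z ∣                    ≤⟨ ℤ.+≤+ (ℕₚ.m≤m*n ℤ.∣ z ∣ (suc d)) ⟩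
  ℤ.+ (ℤ.∣ z ∣ ℕ.* suc d)         ≡⟨ ℤₚ.pos-* ℤ.∣ z ∣ (suc d) ⟩
  ℤ.+ ℤ.∣ z ∣ ℤ.* ℤ.+ suc d      ∎)
  where
  open ℤₚ.≤-Reasoning
  i≤+∣i∣ : ∀ i → i ℤ.≤ ℤ.+ ℤ.∣ i ∣
  i≤+∣i∣ (ℤ.+ n)    = ℤₚ.≤-refl
  i≤+∣i∣ ℤ.-[1+ n ] = ℤ.-≤+

archimedean : ∀ {E} → 0ℚ < E → ∃ λ n → 1ℚ ≤ ℕtoℚ n * E
archimedean {E} 0<E = ℤ.∣ ↥ E⁻¹ ∣ , (begin
  1ℚ                         ≡⟨ ℚₚ.*-inverseˡ E ⟨
  E⁻¹ * E                    ≤⟨ ℚₚ.*-monoʳ-≤-nonNeg E {{nonNegative (ℚₚ.<⇒≤ 0<E)}} (≤ℕtoℚ∣↥∣ E⁻¹) ⟩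
  ℕtoℚ ℤ.∣ ↥ E⁻¹ ∣ * E       ∎)
  where
  open ℚₚ.≤-Reasoning
  instance
    E≢0 : NonZero E
    E≢0 = ℚₚ.pos⇒nonZero E {{positive 0<E}}
  E⁻¹ = 1/ E

½^n-vanishes : ∀ {E} → 0ℚ < E → ∃ λ n → powℚ ½ n ≤ E
½^n-vanishes {E} 0<E with archimedean 0<E
... | n , 1≤nE = n , (begin
  powℚ ½ n
    ≡⟨ ℚₚ.*-identityʳ (powℚ ½ n) ⟨
  powℚ ½ n * 1ℚ
    ≤⟨ ℚₚ.*-monoˡ-≤-nonNeg (powℚ ½ n) {{½^n≥0}} 1≤nE ⟩
  powℚ ½ n * (ℕtoℚ n * E)
    ≤⟨ ℚₚ.*-monoˡ-≤-nonNeg (powℚ ½ n) {{½^n≥0}}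
         (ℚₚ.*-monoʳ-≤-nonNeg E {{nonNegative (ℚₚ.<⇒≤ 0<E)}} (ℕtoℚ-mono-≤ (ℕₚ.<⇒≤ (n<2^n n)))) ⟩
  powℚ ½ n * (ℕtoℚ (2 ^ n) * E)
    ≡⟨ ℚₚ.*-assoc (powℚ ½ n) (ℕtoℚ (2 ^ n)) E ⟨
  (powℚ ½ n * ℕtoℚ (2 ^ n)) * E
    ≡⟨ cong (_* E) (trans (ℚₚ.*-comm (powℚ ½ n) (ℕtoℚ (2 ^ n))) (2^n*½^n≡1 n)) ⟩
  1ℚ * E
    ≡⟨ ℚₚ.*-identityˡ E ⟩
  E ∎)
  where
  open ℚₚ.≤-Reasoning
  ½^n≥0 = nonNegative (powℚ-nonNeg {½} n (ℚₚ.≤ᵇ⇒≤ _))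

dyadic-scale : ∀ {E} → 0ℚ < E → E < powℚ ½ 2 → ∃ λ n → E < powℚ ½ (2 ℕ.+ n) × powℚ ½ (3 ℕ.+ n) ≤ E
dyadic-scale {E} 0<E E<¼ =
  let m , ½^m≤E = ½^n-vanishes 0<E
      n , ¬½^[2+n]≤E , ½^[3+n]≤E = first-crossing (λ t → powℚ ½ (2 ℕ.+ t) ℚₚ.≤? E) ¬½^2≤E m
        (ℚₚ.≤-trans (ℚₚ.≤-trans (½^[1+n]≤½^n (suc m)) (½^[1+n]≤½^n m)) ½^m≤E)
  in n , ℚₚ.≰⇒> ¬½^[2+n]≤E , ½^[3+n]≤E
  where
  ¬½^2≤E : ¬ (powℚ ½ 2 ≤ E)
  ¬½^2≤E ¼≤E = ℚₚ.<-irrefl refl (ℚₚ.<-≤-trans E<¼ ¼≤E)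

codeLength*E≤½ : ∀ n {E} → E < powℚ ½ (2 ℕ.+ n) → ℕtoℚ (codeLength (suc n)) * E ≤ ½
codeLength*E≤½ n {E} E<½^[2+n] = begin
  ℕtoℚ (codeLength (suc n)) * E
    ≡⟨ cong (λ k → ℕtoℚ k * E) (length-allPoints (suc n)) ⟩
  ℕtoℚ (2 ^ suc n) * E
    ≤⟨ ℚₚ.*-monoˡ-≤-nonNeg (ℕtoℚ (2 ^ suc n)) {{nonNegative (ℕtoℚ-nonNeg (2 ^ suc n))}} (ℚₚ.<⇒≤ E<½^[2+n]) ⟩
  ℕtoℚ (2 ^ suc n) * powℚ ½ (1 ℕ.+ suc n)
    ≡⟨ 2^m*½^[j+m]≡½^j 1 (suc n) ⟩
  ½ * 1ℚ
    ≡⟨ ℚₚ.*-identityʳ ½ ⟩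
  ½ ∎
  where open ℚₚ.≤-Reasoning

½^3≤d*E : ∀ n {d E} → 2 ^ n ℕ.≤ d → powℚ ½ (3 ℕ.+ n) ≤ E → powℚ ½ 3 ≤ ℕtoℚ d * E
½^3≤d*E n {d} {E} 2^n≤d ½^[3+n]≤E = begin
  powℚ ½ 3
    ≡⟨ 2^m*½^[j+m]≡½^j 3 n ⟨
  ℕtoℚ (2 ^ n) * powℚ ½ (3 ℕ.+ n)
    ≤⟨ ℚₚ.*-monoˡ-≤-nonNeg (ℕtoℚ (2 ^ n)) {{nonNegative (ℕtoℚ-nonNeg (2 ^ n))}} ½^[3+n]≤E ⟩
  ℕtoℚ (2 ^ n) * E
    ≤⟨ ℚₚ.*-monoʳ-≤-nonNeg E {{nonNegative 0≤E}} (ℕtoℚ-mono-≤ 2^n≤d) ⟩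
  ℕtoℚ d * E ∎
  where
  open ℚₚ.≤-Reasoning
  0≤E = ℚₚ.≤-trans (powℚ-nonNeg {½} (3 ℕ.+ n) (ℚₚ.≤ᵇ⇒≤ _)) ½^[3+n]≤E

theorem6p13 :
    Σ ℚ λ C → Σ ℚ λ c → Σ ℚ λ ε₀ →
      0ℚ < C × 0ℚ < c × 0ℚ < ε₀ ×
      ((ε : ℚ) → 0ℚ < ε → ε ≤ ε₀ →
        Σ ℕ λ k → (ℕtoℚ k * (ε * ε) ≤ C) ×
          Σ (Cube k → ℚ) λ f →
            SelfBounding f ×
            ((x : Cube k) → (0ℚ ≤ f x) × (f x ≤ 1ℚ)) ×
            ((d : ℕ) → ApproxDegLE f ε d → c ≤ ℕtoℚ d * (ε * ε)))
theorem6p13 =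
  ½ , powℚ ½ 3 , powℚ ½ 2 , ℚₚ.positive⁻¹ ½ , ℚₚ.positive⁻¹ (powℚ ½ 3) , ℚₚ.positive⁻¹ (powℚ ½ 2) ,
  λ ε 0<ε ε≤¼ →
    let ε²<¼ = ℚₚ.<-≤-trans (square-<-self 0<ε (ℚₚ.≤-<-trans ε≤¼ ¼<1)) ε≤¼
        n , ε²<½^[2+n] , ½^[3+n]≤ε² = dyadic-scale (square-pos 0<ε) ε²<¼
    in codeLength (suc n) , codeLength*E≤½ n ε²<½^[2+n] ,
       nonCodeword (suc n) , nonCodeword-selfBounding (suc n) , (λ x → bit-∈[0,1] (not (isCodeword (suc n) x))) ,
       λ d approx → ½^3≤d*E n (approxDegLE-nonCodeword n ε ε²<½^[2+n] approx) ½^[3+n]≤ε²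
  where
  ¼<1 : powℚ ½ 2 < 1ℚ
  ¼<1 = *<* (ℤ.+<+ (s≤s (s≤s z≤n)))
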